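{- Let $G_1, G_2, \ldots, G_n$ be a sequence of contracted graphs (in the sense of the context) in which each $G_{i+1}$ is obtained from $G_i$ by merging two of its vertices (clusters). Let $v$ be a cluster that is a vertex of each of $G_l, G_{l+1}, \ldots, G_r$, and for $l \le i \le r$ let $w^i_{\max}(v)$ denote the value of $w_{\max}(v)$ in $G_i$. Then $w^l_{\max}(v) \ge w^{l+1}_{\max}(v) \ge \cdots \ge w^r_{\max}(v)$.
   Context: Let $G=(V,E,w)$ be a finite undirected graph with positive edge weights. A cluster is a nonempty subset of $V$. For disjoint clusters $X,Y$ define the average-linkage similarity $w(X,Y)=\frac{1}{|X|\,|Y|}\sum_{xy\in E,\ x\in X,\ y\in Y} w(xy)$. Given a partition of $V$ into clusters, the contracted graph has the clusters as vertices, with an edge between clusters $X,Y$ iff $w(X,Y)>0$, of weight $w(X,Y)$. Initially every vertex of $V$ is its own (singleton) cluster. Merging two clusters $X,Y$ replaces them by $X\cup Y$ (and recomputes the incident edge weights by the formula above). For a vertex (cluster) $v$ of a contracted graph, $w_{\max}(v)$ is the maximum weight of an edge incident to $v$ in that graph (taken to be $0$ if $v$ has no incident edge). -}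

module Defs where

open import Data.Nat as ℕ using (ℕ; zero; suc; _<_; _≤_)
open import Data.Integer using (+_)
open import Data.Rational using (ℚ; 0ℚ; _+_; _*_; _/_; _⊔_) renaming (_≤_ to _≤ℚ_)
open import Data.Bool using (Bool; true; false; if_then_else_; _∧_)
open import Data.Bool.Properties using () renaming (_≟_ to _≟B_)
open import Data.Fin using (Fin)
open import Data.Fin.Subset using (Subset; _∪_; ∣_∣; Empty)
open import Data.Vec using (lookup)
open import Data.Vec.Properties using (≡-dec)
open import Data.List using (List; []; _∷_; foldr; map; allFin)
open import Data.List.Relation.Unary.All using (All)
open import Data.List.Membership.Propositional using (_∈_)
open import Data.List.Relation.Binary.Permutation.Propositional using (_↭_)
open import Data.Product using (Σ; ∃; ∃₂; _×_)
open import Relation.Binary.PropositionalEquality using (_≡_)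
open import Data.List.Relation.Unary.Unique.Propositional using (Unique)
open import Relation.Nullary using (¬_; yes; no)

-- A weighted undirected graph on vertex set Fin N, given by a weight
-- function: xy is an edge iff w x y > 0, with weight w x y.
record WGraph (N : ℕ) : Set where
  field
    w     : Fin N → Fin N → ℚ
    sym   : ∀ x y → w x y ≡ w y x
    nonneg : ∀ x y → 0ℚ ≤ℚ w x y

open WGraph public

Cluster : ℕ → Set
Cluster N = Subset N

-- q / d for a natural d (convention q / 0 = 0; never used on nonempty clusters)
divℕ : ℚ → ℕ → ℚ
divℕ q zero = 0ℚ
divℕ q (suc k) = q * ((+ 1) / suc k)

sumℚ : List ℚ → ℚ
sumℚ = foldr _+_ 0ℚ

crossSum : ∀ {N} → WGraph N → Cluster N → Cluster N → ℚ
crossSum G X Y =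
  sumℚ (map (λ x → sumℚ (map (λ y →
     if lookup X x ∧ lookup Y y then w G x y else 0ℚ) (allFin _))) (allFin _))

avgLink : ∀ {N} → WGraph N → Cluster N → Cluster N → ℚ
avgLink G X Y = divℕ (crossSum G X Y) (∣ X ∣ ℕ.* ∣ Y ∣)

Disjoint : ∀ {N} → Cluster N → Cluster N → Set
Disjoint X Y = ∀ x → lookup X x ≡ true → lookup Y x ≡ false

record IsPartition {N : ℕ} (P : List (Cluster N)) : Set where
  field
    nonempty : All (λ X → ¬ Empty X) P
    covers   : ∀ x → Σ (Cluster N) (λ X → X ∈ P × lookup X x ≡ true)
    disjoint : ∀ x X Y → X ∈ P → Y ∈ P → lookup X x ≡ true → lookup Y x ≡ true → X ≡ Y
    noDup    : Unique P

Merge : ∀ {N} → List (Cluster N) → List (Cluster N) → Set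
Merge {N} P Q = Σ (Cluster N) λ X → Σ (Cluster N) λ Y → Σ (List (Cluster N)) λ R →
  (P ↭ (X ∷ Y ∷ R)) × (Q ↭ ((X ∪ Y) ∷ R))

-- w_max(v) in the contracted graph of partition P: maximum weight of an edge
-- incident to v (edges = other clusters X with w(v,X) > 0); 0 if none.
-- Since all w(v,X) ≥ 0, this is the max over clusters X ≠ v of w(v,X), with default 0.
wmax : ∀ {N} → WGraph N → List (Cluster N) → Cluster N → ℚ
wmax G [] v = 0ℚ
wmax G (X ∷ P) v with ≡-dec _≟B_ X v
... | yes _ = wmax G P v
... | no  _ = avgLink G v X ⊔ wmax G P v

{-# OPTIONS --safe #-}
-- Merging two clusters X, Y other than v replaces the edges vX, vY by one
-- edge v(X ∪ Y) whose average-linkage weight is a mediant of w(v,X) and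
-- w(v,Y): its numerator and denominator are the sums of theirs, because
-- X and Y are disjoint. A mediant never exceeds the larger of the two, and
-- all other edges at v are unchanged, so w_max(v) cannot increase.
module Submission where

open import Defs hiding (sym)
open import Data.Nat using (ℕ; zero; suc; _<_; _≤_)
open import Data.Rational using () renaming (_≤_ to _≤ℚ_)
open import Data.List using (List)
open import Data.List.Membership.Propositional using (_∈_)
open import Data.Fin.Subset using (Subset)

import Data.Nat as ℕ
import Data.Nat.Properties as ℕ
open import Data.Integer as ℤ using (+_)
import Data.Integer.Properties as ℤ
open import Data.Integer.Tactic.RingSolver using (solve-∀)
open import Data.Rational using (ℚ; 0ℚ; 1ℚ; _+_; _*_; _/_; toℚᵘ)
open import Data.Rational.Properties
  using (toℚᵘ-injective; toℚᵘ-homo-*; toℚᵘ-homo-+; toℚᵘ-fromℚᵘ; normalize-nonNeg; normalize-pos;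
         *-identityʳ; *-assoc; *-monoʳ-≤-nonNeg; *-cancelʳ-≤-pos; *-distribˡ-+; +-mono-≤; +-identityˡ; +-identityʳ;
         +-0-commutativeMonoid; ≤-refl; ≤-trans; p≤p⊔q; p≤q⊔p; ⊔-lub; module ≤-Reasoning)
import Data.Rational.Unnormalised as ℚᵘ
import Data.Rational.Unnormalised.Properties as ℚᵘ
open import Algebra.Bundles using (CommutativeMonoid)
open import Algebra.Properties.CommutativeSemigroup
  (CommutativeMonoid.commutativeSemigroup +-0-commutativeMonoid) using (interchange)
open import Relation.Binary.PropositionalEquality
open import Data.Bool using (true; false; if_then_else_; _∧_; _∨_)
open import Data.Bool.Properties using () renaming (_≟_ to _≟B_)
import Data.Vec as Vec
open import Data.Vec using ([]; _∷_; lookup)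
open import Data.Vec.Properties using (≡-dec; []=⇒lookup; lookup-zipWith)
import Data.Fin as Fin
open import Data.Fin.Subset using (_∪_; ∣_∣; Empty; outside; inside)
open import Data.Fin.Subset.Properties using (x∈p∪q⁺)
open import Data.List using ([]; _∷_; map; allFin)
open import Data.List.Relation.Unary.All as All using (All; []; _∷_)
open import Data.List.Relation.Unary.Any using (here; there)
open import Data.List.Relation.Unary.AllPairs using (AllPairs; []; _∷_)
open import Data.List.Relation.Binary.Permutation.Propositional using (_↭_; ↭-sym; ↭⇒↭ₛ)
open import Data.List.Relation.Binary.Permutation.Propositional.Properties using (All-resp-↭; ∈-resp-↭)
open import Data.Product using (_×_; _,_)
open import Data.Sum using (_⊎_; inj₁; inj₂)
open import Data.Empty using (⊥-elim)
open import Function using (_∘_)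
open import Relation.Nullary using (¬_; yes; no)

fromℕ : ℕ → ℚ
fromℕ n = + n / 1

fromℕ-+ : ∀ m n → fromℕ (m ℕ.+ n) ≡ fromℕ m + fromℕ n
fromℕ-+ m n = toℚᵘ-injective (begin
  toℚᵘ (fromℕ (m ℕ.+ n))                ≈⟨ toℚᵘ-fromℚᵘ (ℚᵘ.mkℚᵘ (+ (m ℕ.+ n)) 0) ⟩
  ℚᵘ.mkℚᵘ (+ (m ℕ.+ n)) 0               ≈⟨ ℚᵘ.*≡* (trans (cong (ℤ._* (+ 1 ℤ.* + 1)) (ℤ.pos-+ m n))
                                                           (cross-multiplied (+ m) (+ n))) ⟩
  ℚᵘ.mkℚᵘ (+ m) 0 ℚᵘ.+ ℚᵘ.mkℚᵘ (+ n) 0 ≈˘⟨ ℚᵘ.+-cong (toℚᵘ-fromℚᵘ (ℚᵘ.mkℚᵘ (+ m) 0))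
                                                    (toℚᵘ-fromℚᵘ (ℚᵘ.mkℚᵘ (+ n) 0)) ⟩
  toℚᵘ (fromℕ m) ℚᵘ.+ toℚᵘ (fromℕ n)    ≈˘⟨ toℚᵘ-homo-+ (fromℕ m) (fromℕ n) ⟩
  toℚᵘ (fromℕ m + fromℕ n)              ∎)
  where
  open import Relation.Binary.Reasoning.Setoid ℚᵘ.≃-setoid
  cross-multiplied : ∀ a b → (a ℤ.+ b) ℤ.* (+ 1 ℤ.* + 1) ≡ (a ℤ.* + 1 ℤ.+ b ℤ.* + 1) ℤ.* + 1
  cross-multiplied = solve-∀

1/[1+k]*[1+k]≡1 : ∀ k → (+ 1 / suc k) * fromℕ (suc k) ≡ 1ℚ
1/[1+k]*[1+k]≡1 k = toℚᵘ-injective (begin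
  toℚᵘ ((+ 1 / suc k) * fromℕ (suc k))         ≈⟨ toℚᵘ-homo-* (+ 1 / suc k) (fromℕ (suc k)) ⟩
  toℚᵘ (+ 1 / suc k) ℚᵘ.* toℚᵘ (fromℕ (suc k)) ≈⟨ ℚᵘ.*-cong (toℚᵘ-fromℚᵘ (ℚᵘ.mkℚᵘ (+ 1) k))
                                                            (toℚᵘ-fromℚᵘ (ℚᵘ.mkℚᵘ (+ suc k) 0)) ⟩
  ℚᵘ.mkℚᵘ (+ 1) k ℚᵘ.* ℚᵘ.mkℚᵘ (+ suc k) 0     ≈⟨ ℚᵘ.*≡* (cross-multiplied (+ suc k)) ⟩
  ℚᵘ.1ℚᵘ                                        ∎)
  where
  open import Relation.Binary.Reasoning.Setoid ℚᵘ.≃-setoid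
  cross-multiplied : ∀ a → (+ 1 ℤ.* a) ℤ.* + 1 ≡ + 1 ℤ.* (a ℤ.* + 1)
  cross-multiplied = solve-∀

divℕ-suc-cancelʳ : ∀ p k → divℕ p (suc k) * fromℕ (suc k) ≡ p
divℕ-suc-cancelʳ p k = begin
  p * (+ 1 / suc k) * fromℕ (suc k)   ≡⟨ *-assoc p (+ 1 / suc k) (fromℕ (suc k)) ⟩
  p * ((+ 1 / suc k) * fromℕ (suc k)) ≡⟨ cong (p *_) (1/[1+k]*[1+k]≡1 k) ⟩
  p * 1ℚ                              ≡⟨ *-identityʳ p ⟩
  p                                   ∎
  where open ≡-Reasoning

divℕ-suc≤⇒≤* : ∀ {p c} k → divℕ p (suc k) ≤ℚ c → p ≤ℚ c * fromℕ (suc k)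
divℕ-suc≤⇒≤* {p} {c} k p/s≤c = begin
  p                                 ≡⟨ sym (divℕ-suc-cancelʳ p k) ⟩
  divℕ p (suc k) * fromℕ (suc k)    ≤⟨ *-monoʳ-≤-nonNeg (fromℕ (suc k)) {{normalize-nonNeg (suc k) 1}} p/s≤c ⟩
  c * fromℕ (suc k)                 ∎
  where open ≤-Reasoning

≤*⇒divℕ-suc≤ : ∀ {p c} k → p ≤ℚ c * fromℕ (suc k) → divℕ p (suc k) ≤ℚ c
≤*⇒divℕ-suc≤ {p} k p≤cs = *-cancelʳ-≤-pos (fromℕ (suc k)) {{normalize-pos (suc k) 1}}
  (subst (_≤ℚ _) (sym (divℕ-suc-cancelʳ p k)) p≤cs)

divℕ-mediant-≤ : ∀ {p q c s t} → 0 < s → 0 < t →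
  divℕ p s ≤ℚ c → divℕ q t ≤ℚ c → divℕ (p + q) (s ℕ.+ t) ≤ℚ c
divℕ-mediant-≤ {p} {q} {c} {suc k} {suc l} _ _ p/s≤c q/t≤c = ≤*⇒divℕ-suc≤ (k ℕ.+ suc l) (begin
  p + q                                     ≤⟨ +-mono-≤ (divℕ-suc≤⇒≤* {p} k p/s≤c) (divℕ-suc≤⇒≤* {q} l q/t≤c) ⟩
  c * fromℕ (suc k) + c * fromℕ (suc l)     ≡⟨ sym (*-distribˡ-+ c (fromℕ (suc k)) (fromℕ (suc l))) ⟩
  c * (fromℕ (suc k) + fromℕ (suc l))       ≡⟨ cong (c *_) (sym (fromℕ-+ (suc k) (suc l))) ⟩
  c * fromℕ (suc k ℕ.+ suc l)               ∎)
  where open ≤-Reasoning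

sumℚ-map-+ : ∀ {A : Set} {f g h : A → ℚ} → (∀ x → h x ≡ f x + g x) →
  ∀ xs → sumℚ (map h xs) ≡ sumℚ (map f xs) + sumℚ (map g xs)
sumℚ-map-+ h≗f+g []       = sym (+-identityʳ 0ℚ)
sumℚ-map-+ {f = f} {g} {h} h≗f+g (x ∷ xs) = begin
  h x + sumℚ (map h xs)                             ≡⟨ cong₂ _+_ (h≗f+g x) (sumℚ-map-+ h≗f+g xs) ⟩
  (f x + g x) + (sumℚ (map f xs) + sumℚ (map g xs)) ≡⟨ interchange (f x) (g x) (sumℚ (map f xs)) (sumℚ (map g xs)) ⟩
  (f x + sumℚ (map f xs)) + (g x + sumℚ (map g xs)) ∎
  where open ≡-Reasoning

if-∧-∨ : ∀ a b c (x : ℚ) → (b ≡ true → c ≡ false) →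
  (if a ∧ (b ∨ c) then x else 0ℚ) ≡ (if a ∧ b then x else 0ℚ) + (if a ∧ c then x else 0ℚ)
if-∧-∨ false b     c     x _   = sym (+-identityʳ 0ℚ)
if-∧-∨ true  true  c     x b⇒¬c rewrite b⇒¬c refl = sym (+-identityʳ x)
if-∧-∨ true  false true  x _   = sym (+-identityˡ x)
if-∧-∨ true  false false x _   = sym (+-identityʳ 0ℚ)

crossSum-∪ʳ : ∀ {N} (G : WGraph N) (v X Y : Subset N) → Disjoint X Y →
  crossSum G v (X ∪ Y) ≡ crossSum G v X + crossSum G v Y
crossSum-∪ʳ G v X Y X#Y = sumℚ-map-+ (λ x → sumℚ-map-+ (λ y →
  trans (cong (λ b → if lookup v x ∧ b then w G x y else 0ℚ) (lookup-zipWith _∨_ y X Y))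
        (if-∧-∨ (lookup v x) (lookup X y) (lookup Y y) (w G x y) (X#Y y))) (allFin _)) (allFin _)

∣∪∣-disjoint : ∀ {n} (X Y : Subset n) → Disjoint X Y → ∣ X ∪ Y ∣ ≡ ∣ X ∣ ℕ.+ ∣ Y ∣
∣∪∣-disjoint []            []            _   = refl
∣∪∣-disjoint (inside  ∷ X) (y       ∷ Y) X#Y with X#Y Fin.zero refl
... | refl = cong suc (∣∪∣-disjoint X Y (X#Y ∘ Fin.suc))
∣∪∣-disjoint (outside ∷ X) (inside  ∷ Y) X#Y =
  trans (cong suc (∣∪∣-disjoint X Y (X#Y ∘ Fin.suc))) (sym (ℕ.+-suc ∣ X ∣ ∣ Y ∣))
∣∪∣-disjoint (outside ∷ X) (outside ∷ Y) X#Y = ∣∪∣-disjoint X Y (X#Y ∘ Fin.suc)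

¬Empty⇒∣∣>0 : ∀ {n} {X : Subset n} → ¬ Empty X → 0 < ∣ X ∣
¬Empty⇒∣∣>0 {X = []}          X≢∅ = ⊥-elim (X≢∅ λ ())
¬Empty⇒∣∣>0 {X = inside  ∷ X} X≢∅ = ℕ.s≤s ℕ.z≤n
¬Empty⇒∣∣>0 {X = outside ∷ X} X≢∅ = ¬Empty⇒∣∣>0 {X = X} λ X≡∅ →
  X≢∅ λ { (Fin.suc x , Vec.there x∈X) → X≡∅ (x , x∈X) }

avgLink-∪ʳ : ∀ {N} (G : WGraph N) (v X Y : Subset N) → Disjoint X Y →
  avgLink G v (X ∪ Y) ≡ divℕ (crossSum G v X + crossSum G v Y) (∣ v ∣ ℕ.* ∣ X ∣ ℕ.+ ∣ v ∣ ℕ.* ∣ Y ∣)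
avgLink-∪ʳ G v X Y X#Y = cong₂ divℕ (crossSum-∪ʳ G v X Y X#Y)
  (trans (cong (∣ v ∣ ℕ.*_) (∣∪∣-disjoint X Y X#Y)) (ℕ.*-distribˡ-+ (∣ v ∣) (∣ X ∣) (∣ Y ∣)))

avgLink-∪ʳ-≤ : ∀ {N} (G : WGraph N) (v X Y : Subset N) {c : ℚ} →
  ¬ Empty v → ¬ Empty X → ¬ Empty Y → Disjoint X Y →
  avgLink G v X ≤ℚ c → avgLink G v Y ≤ℚ c → avgLink G v (X ∪ Y) ≤ℚ c
avgLink-∪ʳ-≤ G v X Y {c} v≢∅ X≢∅ Y≢∅ X#Y vX≤c vY≤c = subst (_≤ℚ c) (sym (avgLink-∪ʳ G v X Y X#Y))
  (divℕ-mediant-≤ (ℕ.*-mono-< ∣v∣>0 (¬Empty⇒∣∣>0 X≢∅)) (ℕ.*-mono-< ∣v∣>0 (¬Empty⇒∣∣>0 Y≢∅)) vX≤c vY≤c)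
  where
  ∣v∣>0 : 0 < ∣ v ∣
  ∣v∣>0 = ¬Empty⇒∣∣>0 v≢∅

Disjoint-sym : ∀ {n} {X Y : Subset n} → Disjoint X Y → Disjoint Y X
Disjoint-sym {X = X} X#Y x x∈Y with lookup X x in x∈?X
... | false = refl
... | true  with () ← trans (sym x∈Y) (X#Y x x∈?X)

¬Empty⇒¬Disjoint-self : ∀ {n} {X : Subset n} → ¬ Empty X → ¬ Disjoint X X
¬Empty⇒¬Disjoint-self X≢∅ X#X = X≢∅ λ (x , x∈X) →
  true≢false (trans (sym ([]=⇒lookup x∈X)) (X#X x ([]=⇒lookup x∈X)))
  where
  true≢false : true ≢ false
  true≢false ()

lookup-∪-true : ∀ {n} (X Y : Subset n) x → lookup (X ∪ Y) x ≡ true → lookup X x ≡ true ⊎ lookup Y x ≡ true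
lookup-∪-true X Y x x∈X∪Y with lookup X x | lookup Y x | trans (sym (lookup-zipWith _∨_ x X Y)) x∈X∪Y
... | true  | _    | _ = inj₁ refl
... | false | true | _ = inj₂ refl

Disjoint-∪ˡ : ∀ {n} (X Y : Subset n) {Z : Subset n} → Disjoint X Z → Disjoint Y Z → Disjoint (X ∪ Y) Z
Disjoint-∪ˡ X Y X#Z Y#Z x x∈X∪Y with lookup-∪-true X Y x x∈X∪Y
... | inj₁ x∈X = X#Z x x∈X
... | inj₂ x∈Y = Y#Z x x∈Y

¬Empty-∪ˡ : ∀ {n} (X Y : Subset n) → ¬ Empty X → ¬ Empty (X ∪ Y)
¬Empty-∪ˡ X Y X≢∅ X∪Y≡∅ = X≢∅ λ (x , x∈X) → X∪Y≡∅ (x , x∈p∪q⁺ {p = X} {q = Y} (inj₁ x∈X))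

AllPairs-map-∈ : ∀ {A : Set} {R S : A → A → Set} {xs : List A} →
  (∀ {x y} → x ∈ xs → y ∈ xs → R x y → S x y) → AllPairs R xs → AllPairs S xs
AllPairs-map-∈ R⇒S []         = []
AllPairs-map-∈ R⇒S (Rx ∷ Rxs) =
  All.tabulate (λ y∈xs → R⇒S (here refl) (there y∈xs) (All.lookup Rx y∈xs))
  ∷ AllPairs-map-∈ (λ x∈xs y∈xs → R⇒S (there x∈xs) (there y∈xs)) Rxs

-- The invariant kept along a merge sequence; unlike IsPartition it does not
-- mention covering, which merges preserve but the argument never needs.
DisjointNonempty : ∀ {n} → List (Subset n) → Set
DisjointNonempty P = All (¬_ ∘ Empty) P × AllPairs Disjoint P

IsPartition⇒DisjointNonempty : ∀ {n} {P : List (Subset n)} → IsPartition P → DisjointNonempty P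
IsPartition⇒DisjointNonempty {P = P} part = nonempty , AllPairs-map-∈ distinct⇒Disjoint noDup
  where
  open IsPartition part
  distinct⇒Disjoint : ∀ {X Y} → X ∈ P → Y ∈ P → X ≢ Y → Disjoint X Y
  distinct⇒Disjoint {X} {Y} X∈P Y∈P X≢Y x x∈X with lookup Y x in x∈?Y
  ... | false = refl
  ... | true  = ⊥-elim (X≢Y (disjoint x X Y X∈P Y∈P x∈X x∈?Y))

DisjointNonempty-resp-↭ : ∀ {n} {P Q : List (Subset n)} → P ↭ Q → DisjointNonempty P → DisjointNonempty Q
DisjointNonempty-resp-↭ {n} P↭Q (nonempty , disjoint) =
  All-resp-↭ P↭Q nonempty , AllPairs-resp-↭ (λ {X} {Y} → Disjoint-sym {X = X} {Y}) (resp₂ Disjoint) (↭⇒↭ₛ P↭Q) disjoint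
  where open import Data.List.Relation.Binary.Permutation.Setoid.Properties (setoid (Subset n)) using (AllPairs-resp-↭)

DisjointNonempty-∪ : ∀ {n} {X Y : Subset n} {R} → DisjointNonempty (X ∷ Y ∷ R) → DisjointNonempty ((X ∪ Y) ∷ R)
DisjointNonempty-∪ {X = X} {Y} (X≢∅ ∷ _ ∷ R≢∅ , (_ ∷ X#R) ∷ (Y#R ∷ R#R)) =
  ¬Empty-∪ˡ X Y X≢∅ ∷ R≢∅ , All.zipWith (λ {Z} (X#Z , Y#Z) → Disjoint-∪ˡ X Y {Z} X#Z Y#Z) (X#R , Y#R) ∷ R#R

DisjointNonempty-merge : ∀ {n} {P Q : List (Subset n)} → Merge P Q → DisjointNonempty P → DisjointNonempty Q
DisjointNonempty-merge (X , Y , R , P↭XYR , Q↭X∪YR) =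
  DisjointNonempty-resp-↭ (↭-sym Q↭X∪YR) ∘ DisjointNonempty-∪ ∘ DisjointNonempty-resp-↭ P↭XYR

Disjoint⇒≢ : ∀ {n} {X Y : Subset n} → ¬ Empty Y → Disjoint X Y → X ≢ Y
Disjoint⇒≢ Y≢∅ X#Y refl = ¬Empty⇒¬Disjoint-self Y≢∅ X#Y

wmax-nonNeg : ∀ {N} (G : WGraph N) P v → 0ℚ ≤ℚ wmax G P v
wmax-nonNeg G []      v = ≤-refl
wmax-nonNeg G (X ∷ P) v with ≡-dec _≟B_ X v
... | yes _ = wmax-nonNeg G P v
... | no  _ = ≤-trans (wmax-nonNeg G P v) (p≤q⊔p (avgLink G v X) (wmax G P v))

avgLink≤wmax : ∀ {N} (G : WGraph N) P v {X} → X ∈ P → X ≢ v → avgLink G v X ≤ℚ wmax G P v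
avgLink≤wmax G (Y ∷ P) v X∈P X≢v with ≡-dec _≟B_ Y v | X∈P
... | yes refl | here refl   = ⊥-elim (X≢v refl)
... | yes _    | there X∈P′ = avgLink≤wmax G P v X∈P′ X≢v
... | no  _    | here refl   = p≤p⊔q (avgLink G v Y) (wmax G P v)
... | no  _    | there X∈P′ = ≤-trans (avgLink≤wmax G P v X∈P′ X≢v) (p≤q⊔p (avgLink G v Y) (wmax G P v))

wmax-lub : ∀ {N} (G : WGraph N) P v {c} → 0ℚ ≤ℚ c →
  (∀ {X} → X ∈ P → X ≢ v → avgLink G v X ≤ℚ c) → wmax G P v ≤ℚ c
wmax-lub G []      v 0≤c _       = 0≤c
wmax-lub G (X ∷ P) v 0≤c bounded with ≡-dec _≟B_ X v
... | yes _   = wmax-lub G P v 0≤c (bounded ∘ there)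
... | no  X≢v = ⊔-lub (bounded (here refl) X≢v) (wmax-lub G P v 0≤c (bounded ∘ there))

wmax-merge-≤ : ∀ {N} (G : WGraph N) {P Q : List (Subset N)} (v : Subset N) →
  DisjointNonempty P → Merge P Q → v ∈ Q → wmax G Q v ≤ℚ wmax G P v
wmax-merge-≤ G {P} {Q} v P-disjoint (X , Y , R , P↭XYR , Q↭X∪YR) v∈Q =
  wmax-lub G Q v (wmax-nonNeg G P v) λ Z∈Q Z≢v → bounded (∈-resp-↭ Q↭X∪YR Z∈Q) Z≢v
  where
  old-bound : ∀ {Z} → Z ∈ X ∷ Y ∷ R → Z ≢ v → avgLink G v Z ≤ℚ wmax G P v
  old-bound Z∈XYR = avgLink≤wmax G P v (∈-resp-↭ (↭-sym P↭XYR) Z∈XYR)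
  bounded : ∀ {Z} → Z ∈ (X ∪ Y) ∷ R → Z ≢ v → avgLink G v Z ≤ℚ wmax G P v
  bounded (there Z∈R)  Z≢v = old-bound (there (there Z∈R)) Z≢v
  bounded (here refl) X∪Y≢v with ∈-resp-↭ Q↭X∪YR v∈Q | DisjointNonempty-resp-↭ P↭XYR P-disjoint
  ... | here v≡X∪Y | _ = ⊥-elim (X∪Y≢v (sym v≡X∪Y))
  ... | there v∈R  | X≢∅ ∷ Y≢∅ ∷ R≢∅ , (X#Y ∷ X#R) ∷ (Y#R ∷ _) =
    avgLink-∪ʳ-≤ G v X Y v≢∅ X≢∅ Y≢∅ X#Y
      (old-bound (here refl) (Disjoint⇒≢ v≢∅ (All.lookup X#R v∈R)))
      (old-bound (there (here refl)) (Disjoint⇒≢ v≢∅ (All.lookup Y#R v∈R)))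
    where
    v≢∅ : ¬ Empty v
    v≢∅ = All.lookup R≢∅ v∈R

lemma3p2 : ∀ {N} (G : WGraph N) (n : ℕ) (Gs : ℕ → List (Subset N)) →
    IsPartition (Gs 0) →
    (∀ i → suc i < n → Merge (Gs i) (Gs (suc i))) →
    (l r : ℕ) → l ≤ r → r < n → (v : Subset N) →
    (∀ i → l ≤ i → i ≤ r → v ∈ Gs i) →
    ∀ i → l ≤ i → i < r → wmax G (Gs (suc i)) v ≤ℚ wmax G (Gs i) v
lemma3p2 G n Gs part merge l r _ r<n v v∈Gs i l≤i i<r =
  wmax-merge-≤ G v (invariant i i<n) (merge i (ℕ.≤-<-trans i<r r<n)) (v∈Gs (suc i) (ℕ.m≤n⇒m≤1+n l≤i) i<r)
  where
  i<n : i < n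
  i<n = ℕ.<-trans i<r r<n
  invariant : ∀ j → j < n → DisjointNonempty (Gs j)
  invariant zero    _     = IsPartition⇒DisjointNonempty part
  invariant (suc j) 1+j<n = DisjointNonempty-merge (merge j 1+j<n) (invariant j (ℕ.<-trans (ℕ.n<1+n j) 1+j<n))
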